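{- Let $n,k$ be positive integers and let $\alpha=(\alpha_1,\ldots,\alpha_k)$ be integers with $n\ge\alpha_1\ge\alpha_2\ge\cdots\ge\alpha_k\ge 0$. Define the sets of cells (cell $(i,j)$ lies in row $i$ and column $j$; rows numbered from bottom to top, columns from left to right) $$T=\{(i,j)\mid 1\le i\le k,\ \alpha_1-\alpha_i+1\le j\le n+\alpha_1-\alpha_i\},$$ $$T^*=\{(i,j)\mid 1\le i\le k,\ \alpha_{k-i+1}-\alpha_k+1\le j\le n+\alpha_{k-i+1}-\alpha_k\},$$ so that $T^*$ is (a translate of) the rotation of $T$ through 180 degrees. Then, as multisets, $$AL(T)=AL(T^*).$$
   Context: For a finite set of cells $G$ (a skew diagram) and a cell $x\in G$: the arm length $a_G(x)$ is the number of cells of $G$ in the same row as $x$ and to the right of $x$; the leg length $l_G(x)$ is the number of cells of $G$ in the same column as $x$ and below $x$ (rows are numbered from bottom to top, so "below" means smaller row index). $AL(G)$ denotes the multiset $\{(a_G(x),l_G(x))\mid x\in G\}$ of arm–leg pairs over all cells of $G$. -}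

module Defs where

open import Data.Nat using (ℕ; zero; suc; _+_; _∸_; _<_; _≟_; _<?_)
open import Data.Nat.Properties using ()
open import Data.Product using (_×_; _,_; proj₁; proj₂)
open import Data.List using (List; map; concatMap; upTo; filter; length)
open import Data.Fin using (Fin; toℕ; fromℕ; opposite) renaming (zero to fzero)
open import Data.List using (allFin) public
open import Relation.Nullary.Decidable using (_×-dec_)

-- A cell (i , j) : row i, column j.  Rows numbered bottom to top.
Cell : Set
Cell = ℕ × ℕ

-- A finite set of cells, represented by a (duplicate-free) list.
CellSet : Set
CellSet = List Cell

arm : CellSet → Cell → ℕ
arm G (i , j) = length (filter (λ y → (proj₁ y ≟ i) ×-dec (j <? proj₂ y)) G)

leg : CellSet → Cell → ℕ
leg G (i , j) = length (filter (λ y → (proj₂ y ≟ j) ×-dec (proj₁ y <? i)) G)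

-- AL(G) as a multiset (a list, compared up to permutation)
AL : CellSet → List (ℕ × ℕ)
AL G = map (λ x → (arm G x , leg G x)) G

rowCells : ℕ → ℕ → ℕ → CellSet
rowCells n i s = map (λ t → (i , s + suc t)) (upTo n)

-- Here k = suc m and α_{r} = α (r-1) for r = 1..k (Fin index r-1).
-- T  = {(i,j) | 1 ≤ i ≤ k, α₁ - αᵢ + 1 ≤ j ≤ n + α₁ - αᵢ}
T : (n m : ℕ) → (Fin (suc m) → ℕ) → CellSet
T n m α = concatMap (λ f → rowCells n (suc (toℕ f)) (α fzero ∸ α f)) (allFin (suc m))

-- T* = {(i,j) | 1 ≤ i ≤ k, α_{k-i+1} - α_k + 1 ≤ j ≤ n + α_{k-i+1} - α_k}
-- row i = toℕ f + 1, and α_{k-i+1} = α (opposite f).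
T* : (n m : ℕ) → (Fin (suc m) → ℕ) → CellSet
T* n m α = concatMap (λ f → rowCells n (suc (toℕ f)) (α (opposite f) ∸ α (fromℕ m))) (allFin (suc m))

{-# OPTIONS --safe #-}
-- Row i of T consists of n cells following column sᵢ = α₁ - αᵢ, and s is nondecreasing. An earlier
-- row p reaches the column of the cell of row i with arm a exactly when sᵢ - sₚ ≤ a, so that cell has
-- leg #{p < i | |sᵢ - sₚ| ≤ a}. The shifts αₖ₋ᵢ₊₁ - αₖ of T* have the pairwise distances of s read
-- backwards, and reading backwards turns these "earlier" counts into the "later" counts
-- #{q > i | |sᵢ - s_q| ≤ a}. So it suffices that a sorted sequence has the same multiset of earlier
-- and later counts, which holds by induction: the elements within a of the first one form an initial
-- segment in which each is within a of everything before it.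
module Submission where

open import Data.Fin using (Fin; toℕ; fromℕ; opposite; inject₁) renaming (zero to fzero; suc to fsuc; _≤_ to _≤ᶠ_)
open import Data.Fin.Properties using (≤fromℕ)
open import Data.List using (List; []; _∷_; _++_; _∷ʳ_; [_]; map; concat; concatMap; filter; length; reverse; tabulate; upTo; allFin)
open import Data.List.Properties
  using (filter-accept; filter-reject; filter-++; filter-all; filter-none; length-++; map-++; map-∘; map-cong-local;
         map-tabulate; tabulate-cong; ++-assoc; ++-identityʳ; upTo-∷ʳ; unfold-reverse; reverse-++; reverse-map)
open import Data.List.Relation.Unary.All as All using (All; []; _∷_)
open import Data.List.Relation.Unary.All.Properties using (all-upTo; tabulate⁺; ∷ʳ⁺)
import Data.List.Relation.Unary.All.Properties as Allₚ
open import Data.List.Relation.Unary.AllPairs as AllPairs using (AllPairs; []; _∷_)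
import Data.List.Relation.Unary.AllPairs.Properties as AllPairsₚ
open import Data.List.Relation.Binary.Permutation.Propositional
  using (_↭_; ↭-refl; ↭-sym; ↭-trans; ↭-reflexive; prep; swap; module PermutationReasoning)
open import Data.List.Relation.Binary.Permutation.Propositional.Properties
  using (↭-reverse; ↭-length; filter-↭; All-resp-↭; ++⁺; ++⁺ˡ; shifts; map⁺)
open import Data.Nat using (ℕ; zero; suc; _+_; _∸_; _≤_; _≥_; _<_; _>_; _≟_; _<?_; _≤?_; z≤n; s≤s; ∣_-_∣)
open import Data.Nat.Properties
open import Data.Nat.Tactic.RingSolver using (solve-∀)
open import Data.Product using (_×_; _,_; proj₁; proj₂)
open import Function using (_∘_; flip; _⇔_; mk⇔; Equivalence)
open import Relation.Binary.Definitions using (Tri; tri<; tri≈; tri>)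
open import Relation.Binary.PropositionalEquality using (_≡_; refl; sym; trans; cong; cong₂; subst; subst₂; module ≡-Reasoning)
open import Relation.Nullary using (Dec; yes; no; ¬_; contradiction)
open import Relation.Nullary.Decidable using (_×-dec_)
open import Relation.Unary using (Pred; Decidable)

open import Defs

length-∷ʳ : ∀ {a} {A : Set a} (xs : List A) x → length (xs ∷ʳ x) ≡ suc (length xs)
length-∷ʳ xs x = trans (length-++ xs) (+-comm (length xs) 1)

concatMap-[] : ∀ {a b} {A : Set a} {B : Set b} (xs : List A) → concatMap (λ _ → [] {A = B}) xs ≡ []
concatMap-[] []       = refl
concatMap-[] (x ∷ xs) = concatMap-[] xs

concatMap-∷ : ∀ {a b} {A : Set a} {B : Set b} (u : A → B) (v : A → List B) xs →
              concatMap (λ x → u x ∷ v x) xs ↭ map u xs ++ concatMap v xs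
concatMap-∷ u v []       = ↭-refl
concatMap-∷ u v (x ∷ xs) = prep (u x) (↭-trans (++⁺ˡ (v x) (concatMap-∷ u v xs)) (shifts (v x) (map u xs)))

concatMap-cong-↭ : ∀ {a b} {A : Set a} {B : Set b} {f g : A → List B} → (∀ x → f x ↭ g x) →
                   ∀ xs → concatMap f xs ↭ concatMap g xs
concatMap-cong-↭ f↭g []       = ↭-refl
concatMap-cong-↭ f↭g (x ∷ xs) = ++⁺ (f↭g x) (concatMap-cong-↭ f↭g xs)

AllPairs-reverse : ∀ {a r} {A : Set a} {R : A → A → Set r} {xs} → AllPairs R xs → AllPairs (flip R) (reverse xs)
AllPairs-reverse {xs = []}     []               = []
AllPairs-reverse {xs = x ∷ xs} (x-R-xs ∷ R-xs) =
  subst (AllPairs _) (sym (unfold-reverse x xs))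
        (AllPairsₚ.++⁺ (AllPairs-reverse R-xs) ([] ∷ [])
                       (All.map (_∷ []) (All-resp-↭ (↭-sym (↭-reverse xs)) x-R-xs)))

-- Counting

indicator : ∀ {p} {P : Set p} → Dec P → ℕ
indicator (yes _) = 1
indicator (no _)  = 0

indicator-yes : ∀ {p} {P : Set p} (P? : Dec P) → P → indicator P? ≡ 1
indicator-yes (yes _) _  = refl
indicator-yes (no ¬p) p = contradiction p ¬p

indicator-no : ∀ {p} {P : Set p} (P? : Dec P) → ¬ P → indicator P? ≡ 0
indicator-no (yes p) ¬p = contradiction p ¬p
indicator-no (no _)  _  = refl

indicator-cong : ∀ {p q} {P : Set p} {Q : Set q} (P? : Dec P) (Q? : Dec Q) → P ⇔ Q → indicator P? ≡ indicator Q?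
indicator-cong (yes p)  Q? P⇔Q = sym (indicator-yes Q? (Equivalence.to P⇔Q p))
indicator-cong (no ¬p) Q? P⇔Q = sym (indicator-no Q? (¬p ∘ Equivalence.from P⇔Q))

module _ {a p} {A : Set a} {P : Pred A p} (P? : Decidable P) where

  count : List A → ℕ
  count = length ∘ filter P?

  count-∷ : ∀ x xs → count (x ∷ xs) ≡ indicator (P? x) + count xs
  count-∷ x xs with P? x
  ... | yes _ = refl
  ... | no _  = refl

  count-∷-yes : ∀ {x} xs → P x → count (x ∷ xs) ≡ suc (count xs)
  count-∷-yes xs px = cong length (filter-accept P? px)

  count-∷-no : ∀ {x} xs → ¬ P x → count (x ∷ xs) ≡ count xs
  count-∷-no xs ¬px = cong length (filter-reject P? ¬px)

  count-++ : ∀ xs ys → count (xs ++ ys) ≡ count xs + count ys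
  count-++ xs ys = trans (cong length (filter-++ P? xs ys)) (length-++ (filter P? xs))

  count-∷ʳ : ∀ xs x → count (xs ∷ʳ x) ≡ count xs + indicator (P? x)
  count-∷ʳ xs x = trans (count-++ xs [ x ]) (cong (count xs +_) (trans (count-∷ x []) (+-identityʳ _)))

  count-all : ∀ {xs} → All P xs → count xs ≡ length xs
  count-all = cong length ∘ filter-all P?

  count-none : ∀ {xs} → All (¬_ ∘ P) xs → count xs ≡ 0
  count-none = cong length ∘ filter-none P?

  count-reverse : ∀ xs → count (reverse xs) ≡ count xs
  count-reverse xs = ↭-length (filter-↭ P? (↭-reverse xs))

count-map : ∀ {a b p} {A : Set a} {B : Set b} {P : Pred B p} (P? : Decidable P) (f : A → B) xs →
            count P? (map f xs) ≡ count (P? ∘ f) xs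
count-map P? f []       = refl
count-map P? f (x ∷ xs) = begin
  count P? (f x ∷ map f xs)            ≡⟨ count-∷ P? (f x) (map f xs) ⟩
  indicator (P? (f x)) + count P? (map f xs) ≡⟨ cong (_ +_) (count-map P? f xs) ⟩
  indicator (P? (f x)) + count (P? ∘ f) xs   ≡⟨ count-∷ (P? ∘ f) x xs ⟨
  count (P? ∘ f) (x ∷ xs)              ∎
  where open ≡-Reasoning

count-cong : ∀ {a p q} {A : Set a} {P : Pred A p} {Q : Pred A q} (P? : Decidable P) (Q? : Decidable Q) {xs} →
             All (λ x → P x ⇔ Q x) xs → count P? xs ≡ count Q? xs
count-cong P? Q? []                      = refl
count-cong P? Q? {x ∷ xs} (P⇔Q ∷ P⇔Q-xs) = begin
  count P? (x ∷ xs)               ≡⟨ count-∷ P? x xs ⟩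
  indicator (P? x) + count P? xs  ≡⟨ cong₂ _+_ (indicator-cong (P? x) (Q? x) P⇔Q) (count-cong P? Q? P⇔Q-xs) ⟩
  indicator (Q? x) + count Q? xs  ≡⟨ count-∷ Q? x xs ⟨
  count Q? (x ∷ xs)               ∎
  where open ≡-Reasoning

count-upTo-suc : ∀ {p} {P : Pred ℕ p} (P? : Decidable P) n →
                 count P? (upTo (suc n)) ≡ count P? (upTo n) + indicator (P? n)
count-upTo-suc P? n = trans (cong (count P?) (sym (upTo-∷ʳ n))) (count-∷ʳ P? (upTo n) n)

count-≟-upTo : ∀ c n → count (_≟ c) (upTo n) ≡ indicator (c <? n)
count-≟-upTo c zero    = refl
count-≟-upTo c (suc n) = begin
  count (_≟ c) (upTo (suc n))                  ≡⟨ count-upTo-suc (_≟ c) n ⟩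
  count (_≟ c) (upTo n) + indicator (n ≟ c)    ≡⟨ cong (_+ indicator (n ≟ c)) (count-≟-upTo c n) ⟩
  indicator (c <? n) + indicator (n ≟ c)       ≡⟨ last-step (<-cmp c n) ⟩
  indicator (c <? suc n)                       ∎
  where
  open ≡-Reasoning
  last-step : Tri (c < n) (c ≡ n) (c > n) → indicator (c <? n) + indicator (n ≟ c) ≡ indicator (c <? suc n)
  last-step (tri< c<n _ _) = trans (cong₂ _+_ (indicator-yes (c <? n) c<n) (indicator-no (n ≟ c) (>⇒≢ c<n)))
                                   (sym (indicator-yes (c <? suc n) (m<n⇒m<1+n c<n)))
  last-step (tri≈ _ refl _) = trans (cong₂ _+_ (indicator-no (c <? n) (n≮n c)) (indicator-yes (n ≟ c) refl))
                                    (sym (indicator-yes (c <? suc n) (n<1+n c)))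
  last-step (tri> _ _ n<c) = trans (cong₂ _+_ (indicator-no (c <? n) (<-asym n<c)) (indicator-no (n ≟ c) (<⇒≢ n<c)))
                                   (sym (indicator-no (c <? suc n) (<⇒≱ n<c ∘ ≤-pred)))

count->-upTo : ∀ t n → count (t <?_) (upTo n) ≡ n ∸ suc t
count->-upTo t zero    = refl
count->-upTo t (suc n) = begin
  count (t <?_) (upTo (suc n))               ≡⟨ count-upTo-suc (t <?_) n ⟩
  count (t <?_) (upTo n) + indicator (t <? n) ≡⟨ cong (_+ indicator (t <? n)) (count->-upTo t n) ⟩
  n ∸ suc t + indicator (t <? n)             ≡⟨ last-step (t <? n) ⟩
  n ∸ t                                      ∎
  where
  open ≡-Reasoning
  last-step : (t<?n : Dec (t < n)) → n ∸ suc t + indicator t<?n ≡ n ∸ t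
  last-step (yes t<n) = trans (+-comm (n ∸ suc t) 1) (sym (+-∸-assoc 1 t<n))
  last-step (no t≮n)  = trans (+-identityʳ _) (trans (m≤n⇒m∸n≡0 (m≤n⇒m≤1+n n≤t)) (sym (m≤n⇒m∸n≡0 n≤t)))
    where n≤t = ≮⇒≥ t≮n

-- Close counts

∣-∣-shrinkˡ : ∀ {x y z} → x ≤ y → y ≤ z → ∣ y - z ∣ ≤ ∣ x - z ∣
∣-∣-shrinkˡ {x} {y} {z} x≤y y≤z rewrite m≤n⇒∣m-n∣≡n∸m y≤z | m≤n⇒∣m-n∣≡n∸m (≤-trans x≤y y≤z) = ∸-monoʳ-≤ z x≤y

∣-∣-shrinkʳ : ∀ {x y z} → x ≤ y → y ≤ z → ∣ x - y ∣ ≤ ∣ x - z ∣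
∣-∣-shrinkʳ {x} {y} {z} x≤y y≤z rewrite m≤n⇒∣m-n∣≡n∸m x≤y | m≤n⇒∣m-n∣≡n∸m (≤-trans x≤y y≤z) = ∸-monoˡ-≤ x y≤z

x+u≡y+v⇒∣x-y∣≡∣v-u∣ : ∀ x y u v → x + u ≡ y + v → ∣ x - y ∣ ≡ ∣ v - u ∣
x+u≡y+v⇒∣x-y∣≡∣v-u∣ x y u v eq = begin
  ∣ x - y ∣                         ≡⟨ ∣m+n-m+o∣≡∣n-o∣ (u + v) x y ⟨
  ∣ (u + v) + x - (u + v) + y ∣     ≡⟨ cong₂ ∣_-_∣ (shuffleˡ u v x) (trans (shuffleʳ u v y) (cong (_+ u) (sym eq))) ⟩
  ∣ (x + u) + v - (x + u) + u ∣     ≡⟨ ∣m+n-m+o∣≡∣n-o∣ (x + u) v u ⟩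
  ∣ v - u ∣                         ∎
  where
  open ≡-Reasoning
  shuffleˡ : ∀ u v x → (u + v) + x ≡ (x + u) + v
  shuffleˡ = solve-∀
  shuffleʳ : ∀ u v y → (u + v) + y ≡ (y + v) + u
  shuffleʳ = solve-∀

∣[o∸m]-[o∸n]∣≡∣m-n∣ : ∀ {m n o} → m ≤ o → n ≤ o → ∣ o ∸ m - o ∸ n ∣ ≡ ∣ m - n ∣
∣[o∸m]-[o∸n]∣≡∣m-n∣ {m} {n} {o} m≤o n≤o =
  trans (x+u≡y+v⇒∣x-y∣≡∣v-u∣ (o ∸ m) (o ∸ n) m n (trans (m∸n+n≡m m≤o) (sym (m∸n+n≡m n≤o)))) (∣-∣-comm n m)

∣[m∸o]-[n∸o]∣≡∣m-n∣ : ∀ {m n o} → o ≤ m → o ≤ n → ∣ m ∸ o - n ∸ o ∣ ≡ ∣ m - n ∣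
∣[m∸o]-[n∸o]∣≡∣m-n∣ {m} {n} {o} o≤m o≤n = x+u≡y+v⇒∣x-y∣≡∣v-u∣ (m ∸ o) (n ∸ o) n m (begin
  m ∸ o + n    ≡⟨ +-∸-comm n o≤m ⟨
  m + n ∸ o    ≡⟨ cong (_∸ o) (+-comm m n) ⟩
  n + m ∸ o    ≡⟨ +-∸-comm m o≤n ⟩
  n ∸ o + m    ∎)
  where open ≡-Reasoning

module CloseCounts (a : ℕ) where

  Close : ℕ → ℕ → Set
  Close x y = ∣ x - y ∣ ≤ a

  close? : ∀ x y → Dec (Close x y)
  close? x y = ∣ x - y ∣ ≤? a

  close-sym : ∀ x y → Close x y → Close y x
  close-sym x y = subst (_≤ a) (∣-∣-comm x y)

  closeCount : ℕ → List ℕ → ℕ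
  closeCount x = count (close? x)

  earlierCountsFrom : List ℕ → List ℕ → List ℕ
  earlierCountsFrom pre []       = []
  earlierCountsFrom pre (y ∷ ys) = closeCount y pre ∷ earlierCountsFrom (pre ∷ʳ y) ys

  earlierCounts : List ℕ → List ℕ
  earlierCounts = earlierCountsFrom []

  laterCounts : List ℕ → List ℕ
  laterCounts []       = []
  laterCounts (x ∷ xs) = closeCount x xs ∷ laterCounts xs

  earlierCountsFrom-far : ∀ x pre ys → All (λ y → ¬ Close y x) ys →
                          earlierCountsFrom (x ∷ pre) ys ≡ earlierCountsFrom pre ys
  earlierCountsFrom-far x pre []       []             = refl
  earlierCountsFrom-far x pre (y ∷ ys) (y-far ∷ ys-far) =
    cong₂ _∷_ (count-∷-no (close? y) pre y-far) (earlierCountsFrom-far x (pre ∷ʳ y) ys ys-far)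

  -- The elements of ys close to x form an initial segment y₁ … y_c, each close to all of pre and to
  -- its predecessors; so their counts are ℓ, …, ℓ + c - 1 without x and ℓ + 1, …, ℓ + c with x,
  -- while the other counts do not see x.
  earlierCountsFrom-insert : ∀ x pre ys {ℓ} → length pre ≡ ℓ →
    All (x ≤_) pre → All (λ p → All (p ≤_) ys) pre → AllPairs _≤_ (x ∷ ys) →
    ℓ ∷ earlierCountsFrom (x ∷ pre) ys ↭ (ℓ + closeCount x ys) ∷ earlierCountsFrom pre ys
  earlierCountsFrom-insert x pre [] refl _ _ _ = ↭-reflexive (cong (_∷ []) (sym (+-identityʳ _)))
  earlierCountsFrom-insert x pre (y ∷ ys) {ℓ} len x≤pre pre≤ys ((x≤y ∷ x≤ys) ∷ y≤ys ∷ sorted) with close? x y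
  ... | yes x~y = begin
    ℓ ∷ closeCount y (x ∷ pre) ∷ E′                      ≡⟨ cong (λ c → ℓ ∷ c ∷ E′) y-count ⟩
    ℓ ∷ suc ℓ ∷ E′                                       ↭⟨ prep ℓ IH ⟩
    ℓ ∷ (suc ℓ + closeCount x ys) ∷ E                    ↭⟨ swap ℓ _ ↭-refl ⟩
    (suc ℓ + closeCount x ys) ∷ ℓ ∷ E                    ≡⟨ cong₂ (λ c d → c ∷ d ∷ E) x-count (sym pre-count) ⟩
    (ℓ + closeCount x (y ∷ ys)) ∷ closeCount y pre ∷ E   ∎
    where
    open PermutationReasoning
    E′ = earlierCountsFrom (x ∷ pre ∷ʳ y) ys
    E  = earlierCountsFrom (pre ∷ʳ y) ys
    IH : suc ℓ ∷ E′ ↭ (suc ℓ + closeCount x ys) ∷ E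
    IH = earlierCountsFrom-insert x (pre ∷ʳ y) ys (trans (length-∷ʳ pre y) (cong suc len))
           (∷ʳ⁺ x≤pre x≤y) (∷ʳ⁺ (All.map All.tail pre≤ys) y≤ys) (x≤ys ∷ sorted)
    y~pre : All (Close y) pre
    y~pre = All.zipWith (λ (x≤p , p≤ys) → close-sym _ y (≤-trans (∣-∣-shrinkˡ x≤p (All.head p≤ys)) x~y)) (x≤pre , pre≤ys)
    pre-count : closeCount y pre ≡ ℓ
    pre-count = trans (count-all (close? y) y~pre) len
    y-count : closeCount y (x ∷ pre) ≡ suc ℓ
    y-count = trans (count-∷-yes (close? y) pre (close-sym x y x~y)) (cong suc pre-count)
    x-count : suc ℓ + closeCount x ys ≡ ℓ + closeCount x (y ∷ ys)
    x-count = sym (trans (cong (ℓ +_) (count-∷-yes (close? x) ys x~y)) (+-suc ℓ _))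
  ... | no x≁y = ↭-reflexive (cong₂ _∷_ (sym x-count) (earlierCountsFrom-far x pre (y ∷ ys) far))
    where
    far : All (λ z → ¬ Close z x) (y ∷ ys)
    far = (x≁y ∘ close-sym y x) ∷ All.map (λ {z} y≤z z~x → x≁y (≤-trans (∣-∣-shrinkʳ x≤y y≤z) (close-sym z x z~x))) y≤ys
    x-count : ℓ + closeCount x (y ∷ ys) ≡ ℓ
    x-count = trans (cong (ℓ +_) (count-none (close? x) (All.map (λ {z} z≁x → z≁x ∘ close-sym x z) far))) (+-identityʳ ℓ)

  earlierCounts↭laterCounts : ∀ {xs} → AllPairs _≤_ xs → earlierCounts xs ↭ laterCounts xs
  earlierCounts↭laterCounts {[]}     []               = ↭-refl
  earlierCounts↭laterCounts {x ∷ xs} (x≤xs ∷ sorted) = begin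
    0 ∷ earlierCountsFrom [ x ] xs          ↭⟨ earlierCountsFrom-insert x [] xs refl [] [] (x≤xs ∷ sorted) ⟩
    closeCount x xs ∷ earlierCounts xs      ↭⟨ prep _ (earlierCounts↭laterCounts sorted) ⟩
    closeCount x xs ∷ laterCounts xs        ∎
    where open PermutationReasoning

  earlierCountsFrom-∷ʳ : ∀ pre ys y → earlierCountsFrom pre (ys ∷ʳ y) ≡ earlierCountsFrom pre ys ∷ʳ closeCount y (pre ++ ys)
  earlierCountsFrom-∷ʳ pre []       y = cong (λ zs → closeCount y zs ∷ []) (sym (++-identityʳ pre))
  earlierCountsFrom-∷ʳ pre (z ∷ zs) y = cong (closeCount z pre ∷_) (begin
    earlierCountsFrom (pre ∷ʳ z) (zs ∷ʳ y)                               ≡⟨ earlierCountsFrom-∷ʳ (pre ∷ʳ z) zs y ⟩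
    earlierCountsFrom (pre ∷ʳ z) zs ∷ʳ closeCount y ((pre ∷ʳ z) ++ zs)
      ≡⟨ cong (λ ws → earlierCountsFrom (pre ∷ʳ z) zs ∷ʳ closeCount y ws) (++-assoc pre [ z ] zs) ⟩
    earlierCountsFrom (pre ∷ʳ z) zs ∷ʳ closeCount y (pre ++ z ∷ zs)      ∎)
    where open ≡-Reasoning

  earlierCounts-reverse : ∀ xs → earlierCounts (reverse xs) ≡ reverse (laterCounts xs)
  earlierCounts-reverse []       = refl
  earlierCounts-reverse (x ∷ xs) = begin
    earlierCounts (reverse (x ∷ xs))                          ≡⟨ cong earlierCounts (unfold-reverse x xs) ⟩
    earlierCounts (reverse xs ∷ʳ x)                           ≡⟨ earlierCountsFrom-∷ʳ [] (reverse xs) x ⟩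
    earlierCounts (reverse xs) ∷ʳ closeCount x (reverse xs)   ≡⟨ cong₂ _∷ʳ_ (earlierCounts-reverse xs) (count-reverse (close? x) xs) ⟩
    reverse (laterCounts xs) ∷ʳ closeCount x xs               ≡⟨ unfold-reverse (closeCount x xs) (laterCounts xs) ⟨
    reverse (laterCounts (x ∷ xs))                            ∎
    where open ≡-Reasoning

  earlierCounts↭earlierCounts-reverse : ∀ {xs} → AllPairs _≤_ xs → earlierCounts xs ↭ earlierCounts (reverse xs)
  earlierCounts↭earlierCounts-reverse {xs} sorted = begin
    earlierCounts xs             ↭⟨ earlierCounts↭laterCounts sorted ⟩
    laterCounts xs               ↭⟨ ↭-reverse (laterCounts xs) ⟨
    reverse (laterCounts xs)     ≡⟨ earlierCounts-reverse xs ⟨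
    earlierCounts (reverse xs)   ∎
    where open PermutationReasoning

  earlierCountsFrom-map : ∀ {r} {R : Pred ℕ r} (f : ℕ → ℕ) → (∀ {u v} → R u → R v → ∣ f u - f v ∣ ≡ ∣ u - v ∣) →
    ∀ {pre ys} → All R pre → All R ys → earlierCountsFrom (map f pre) (map f ys) ≡ earlierCountsFrom pre ys
  earlierCountsFrom-map f f-iso {pre} {[]}     R-pre []          = refl
  earlierCountsFrom-map f f-iso {pre} {y ∷ ys} R-pre (R-y ∷ R-ys) = cong₂ _∷_ y-count (begin
    earlierCountsFrom (map f pre ∷ʳ f y) (map f ys)   ≡⟨ cong (λ zs → earlierCountsFrom zs (map f ys)) (map-++ f pre [ y ]) ⟨
    earlierCountsFrom (map f (pre ∷ʳ y)) (map f ys)   ≡⟨ earlierCountsFrom-map f f-iso (∷ʳ⁺ R-pre R-y) R-ys ⟩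
    earlierCountsFrom (pre ∷ʳ y) ys                   ∎)
    where
    open ≡-Reasoning
    y-count : closeCount (f y) (map f pre) ≡ closeCount y pre
    y-count = trans (count-map (close? (f y)) f pre)
                    (count-cong _ (close? y) (All.map (λ R-p → let eq = f-iso R-y R-p in
                                                              mk⇔ (subst (_≤ a) eq) (subst (_≤ a) (sym eq))) R-pre))

  earlierCounts-reflect : ∀ {lo hi vs} → AllPairs _≥_ vs → All (_≤ hi) vs → All (lo ≤_) vs →
    earlierCounts (map (hi ∸_) vs) ↭ earlierCounts (map (_∸ lo) (reverse vs))
  earlierCounts-reflect {lo} {hi} {vs} antitone ≤hi lo≤ = begin
    earlierCounts (map (hi ∸_) vs)              ↭⟨ earlierCounts↭earlierCounts-reverse sorted ⟩
    earlierCounts (reverse (map (hi ∸_) vs))    ≡⟨ cong earlierCounts (reverse-map (hi ∸_) vs) ⟨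
    earlierCounts (map (hi ∸_) (reverse vs))    ≡⟨ earlierCountsFrom-map (hi ∸_) ∣[o∸m]-[o∸n]∣≡∣m-n∣ [] (reversed ≤hi) ⟩
    earlierCounts (reverse vs)                  ≡⟨ earlierCountsFrom-map (_∸ lo) ∣[m∸o]-[n∸o]∣≡∣m-n∣ [] (reversed lo≤) ⟨
    earlierCounts (map (_∸ lo) (reverse vs))    ∎
    where
    open PermutationReasoning
    sorted : AllPairs _≤_ (map (hi ∸_) vs)
    sorted = AllPairsₚ.map⁺ (AllPairs.map (∸-monoʳ-≤ hi) antitone)
    reversed : ∀ {r} {R : Pred ℕ r} → All R vs → All R (reverse vs)
    reversed = All-resp-↭ (↭-sym (↭-reverse vs))

open CloseCounts

-- Diagrams made of rows of n cells

rows : ℕ → ℕ → List ℕ → CellSet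
rows n r []       = []
rows n r (s ∷ ss) = rowCells n (suc r) s ++ rows n (suc r) ss

rows-++ : ∀ n r xs ys → rows n r (xs ++ ys) ≡ rows n r xs ++ rows n (r + length xs) ys
rows-++ n r []       ys = cong (λ r′ → rows n r′ ys) (sym (+-identityʳ r))
rows-++ n r (x ∷ xs) ys = begin
  R ++ rows n (suc r) (xs ++ ys)                               ≡⟨ cong (R ++_) (rows-++ n (suc r) xs ys) ⟩
  R ++ rows n (suc r) xs ++ rows n (suc r + length xs) ys      ≡⟨ cong (λ r′ → R ++ rows n (suc r) xs ++ rows n r′ ys) (+-suc r (length xs)) ⟨
  R ++ rows n (suc r) xs ++ rows n (r + length (x ∷ xs)) ys    ≡⟨ ++-assoc R _ _ ⟨
  rows n r (x ∷ xs) ++ rows n (r + length (x ∷ xs)) ys         ∎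
  where
  open ≡-Reasoning
  R = rowCells n (suc r) x

rowCells-All : ∀ {p} {P : Pred Cell p} n i s → (∀ t → P (i , s + suc t)) → All P (rowCells n i s)
rowCells-All n i s P-cell = Allₚ.map⁺ (All.universal P-cell (upTo n))

rows-above : ∀ n r ss → All (λ y → r < proj₁ y) (rows n r ss)
rows-above n r []       = []
rows-above n r (s ∷ ss) = Allₚ.++⁺ (rowCells-All n (suc r) s (λ _ → ≤-refl)) (All.map (<-trans (n<1+n r)) (rows-above n (suc r) ss))

rows-below : ∀ n r ss → All (λ y → proj₁ y ≤ r + length ss) (rows n r ss)
rows-below n r []       = []
rows-below n r (s ∷ ss) = subst (λ h → All (λ y → proj₁ y ≤ h) (rows n r (s ∷ ss))) (sym (+-suc r (length ss)))
  (Allₚ.++⁺ (rowCells-All n (suc r) s (λ _ → s≤s (m≤m+n r (length ss)))) (rows-below n (suc r) ss))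

sameRowRight? : ∀ i j → Decidable (λ (y : Cell) → proj₁ y ≡ i × j < proj₂ y)
sameRowRight? i j y = (proj₁ y ≟ i) ×-dec (j <? proj₂ y)

sameColumnBelow? : ∀ i j → Decidable (λ (y : Cell) → proj₂ y ≡ j × proj₁ y < i)
sameColumnBelow? i j y = (proj₂ y ≟ j) ×-dec (proj₁ y <? i)

armCount-rowCells : ∀ n i s t → count (sameRowRight? i (s + suc t)) (rowCells n i s) ≡ n ∸ suc t
armCount-rowCells n i s t = begin
  count (sameRowRight? i (s + suc t)) (rowCells n i s)   ≡⟨ count-map (sameRowRight? i (s + suc t)) _ (upTo n) ⟩
  count (λ t′ → sameRowRight? i (s + suc t) (i , s + suc t′)) (upTo n)
    ≡⟨ count-cong _ (t <?_) (All.universal right-of (upTo n)) ⟩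
  count (t <?_) (upTo n)                                  ≡⟨ count->-upTo t n ⟩
  n ∸ suc t                                               ∎
  where
  open ≡-Reasoning
  right-of : ∀ t′ → (i ≡ i × s + suc t < s + suc t′) ⇔ t < t′
  right-of t′ = mk⇔ (≤-pred ∘ +-cancelˡ-< s _ _ ∘ proj₂) (λ t<t′ → refl , +-monoʳ-< s (s≤s t<t′))

-- Row r, shifted by q ≤ s, meets column s + t + 1 in its cell number s - q + t (counting from 0),
-- which exists iff s - q ≤ n - (t + 1).
legCount-rowCells : ∀ {n i r q s t} → r < i → q ≤ s → t < n →
  count (sameColumnBelow? i (s + suc t)) (rowCells n r q) ≡ indicator (close? (n ∸ suc t) s q)
legCount-rowCells {n} {i} {r} {q} {s} {t} r<i q≤s t<n = begin
  count (sameColumnBelow? i (s + suc t)) (rowCells n r q)   ≡⟨ count-map (sameColumnBelow? i (s + suc t)) _ (upTo n) ⟩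
  count (λ t′ → sameColumnBelow? i (s + suc t) (r , q + suc t′)) (upTo n)
    ≡⟨ count-cong _ (_≟ d + t) (All.universal in-column (upTo n)) ⟩
  count (_≟ d + t) (upTo n)                                  ≡⟨ count-≟-upTo (d + t) n ⟩
  indicator (d + t <? n)                                     ≡⟨ indicator-cong (d + t <? n) (close? (n ∸ suc t) s q) (mk⇔ to from) ⟩
  indicator (close? (n ∸ suc t) s q)                         ∎
  where
  open ≡-Reasoning
  d = s ∸ q
  column : s + suc t ≡ q + suc (d + t)
  column = trans (cong (_+ suc t) (sym (m+[n∸m]≡n q≤s))) (trans (+-assoc q d (suc t)) (cong (q +_) (+-suc d t)))
  in-column : ∀ t′ → (q + suc t′ ≡ s + suc t × r < i) ⇔ t′ ≡ d + t
  in-column t′ = mk⇔ (λ (e , _) → suc-injective (+-cancelˡ-≡ q _ _ (trans e column)))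
                     (λ t′≡d+t → trans (cong (λ u → q + suc u) t′≡d+t) (sym column) , r<i)
  distance : ∣ s - q ∣ ≡ d
  distance = m≤n⇒∣n-m∣≡n∸m q≤s
  to : d + t < n → ∣ s - q ∣ ≤ n ∸ suc t
  to d+t<n = subst (_≤ n ∸ suc t) (sym distance) (m+n≤o⇒m≤o∸n d (subst (_≤ n) (sym (+-suc d t)) d+t<n))
  from : ∣ s - q ∣ ≤ n ∸ suc t → d + t < n
  from close = subst (_≤ n) (+-suc d t) (m≤o∸n⇒m+n≤o d t<n (subst (_≤ n ∸ suc t) distance close))

legCount-rows : ∀ {n L s t} → t < n → ∀ r qs → r + length qs ≤ L → All (_≤ s) qs →
  count (sameColumnBelow? (suc L) (s + suc t)) (rows n r qs) ≡ closeCount (n ∸ suc t) s qs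
legCount-rows t<n r []       _         _              = refl
legCount-rows {n} {L} {s} {t} t<n r (q ∷ qs) r+len≤L (q≤s ∷ qs≤s) = begin
  count P (rowCells n (suc r) q ++ rows n (suc r) qs)                   ≡⟨ count-++ P (rowCells n (suc r) q) _ ⟩
  count P (rowCells n (suc r) q) + count P (rows n (suc r) qs)
    ≡⟨ cong₂ _+_ (legCount-rowCells (s≤s r<L) q≤s t<n) (legCount-rows t<n (suc r) qs r+len≤L′ qs≤s) ⟩
  indicator (close? a s q) + closeCount a s qs                          ≡⟨ count-∷ (close? a s) q qs ⟨
  closeCount a s (q ∷ qs)                                               ∎
  where
  open ≡-Reasoning
  P = sameColumnBelow? (suc L) (s + suc t)
  a = n ∸ suc t
  r+len≤L′ : suc r + length qs ≤ L
  r+len≤L′ = subst (_≤ L) (+-suc r (length qs)) r+len≤L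
  r<L : r < L
  r<L = ≤-trans (s≤s (m≤m+n r (length qs))) r+len≤L′

count-rows-split : ∀ {p} {P : Pred Cell p} (P? : Decidable P) n pre s ss → let i = suc (length pre) in
  count P? (rows n 0 (pre ++ s ∷ ss)) ≡ count P? (rows n 0 pre) + (count P? (rowCells n i s) + count P? (rows n i ss))
count-rows-split P? n pre s ss = begin
  count P? (rows n 0 (pre ++ s ∷ ss))                           ≡⟨ cong (count P?) (rows-++ n 0 pre (s ∷ ss)) ⟩
  count P? (rows n 0 pre ++ rowCells n i s ++ rows n i ss)      ≡⟨ count-++ P? (rows n 0 pre) _ ⟩
  count P? (rows n 0 pre) + count P? (rowCells n i s ++ rows n i ss)
    ≡⟨ cong (count P? (rows n 0 pre) +_) (count-++ P? (rowCells n i s) _) ⟩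
  count P? (rows n 0 pre) + (count P? (rowCells n i s) + count P? (rows n i ss)) ∎
  where
  open ≡-Reasoning
  i = suc (length pre)

arm-rows : ∀ n pre s ss t → arm (rows n 0 (pre ++ s ∷ ss)) (suc (length pre) , s + suc t) ≡ n ∸ suc t
arm-rows n pre s ss t = begin
  count P (rows n 0 (pre ++ s ∷ ss))                                            ≡⟨ count-rows-split P n pre s ss ⟩
  count P (rows n 0 pre) + (count P (rowCells n i s) + count P (rows n i ss))   ≡⟨ cong₂ _+_ below (cong₂ _+_ (armCount-rowCells n i s t) above) ⟩
  0 + (n ∸ suc t + 0)                                                           ≡⟨ +-identityʳ (n ∸ suc t) ⟩
  n ∸ suc t                                                                     ∎
  where
  open ≡-Reasoning
  i = suc (length pre)
  P = sameRowRight? i (s + suc t)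
  below : count P (rows n 0 pre) ≡ 0
  below = count-none P (All.map (λ y≤L (y≡i , _) → 1+n≰n (subst (_≤ length pre) y≡i y≤L)) (rows-below n 0 pre))
  above : count P (rows n i ss) ≡ 0
  above = count-none P (All.map (λ i<y (y≡i , _) → <-irrefl (sym y≡i) i<y) (rows-above n i ss))

leg-rows : ∀ n pre s ss t → t < n → All (_≤ s) pre →
  leg (rows n 0 (pre ++ s ∷ ss)) (suc (length pre) , s + suc t) ≡ closeCount (n ∸ suc t) s pre
leg-rows n pre s ss t t<n pre≤s = begin
  count P (rows n 0 (pre ++ s ∷ ss))                                            ≡⟨ count-rows-split P n pre s ss ⟩
  count P (rows n 0 pre) + (count P (rowCells n i s) + count P (rows n i ss))
    ≡⟨ cong₂ _+_ (legCount-rows t<n 0 pre ≤-refl pre≤s) (cong₂ _+_ same above) ⟩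
  closeCount (n ∸ suc t) s pre + 0                                              ≡⟨ +-identityʳ _ ⟩
  closeCount (n ∸ suc t) s pre                                                  ∎
  where
  open ≡-Reasoning
  i = suc (length pre)
  P = sameColumnBelow? i (s + suc t)
  same : count P (rowCells n i s) ≡ 0
  same = count-none P (rowCells-All n i s (λ _ (_ , i<i) → n≮n i i<i))
  above : count P (rows n i ss) ≡ 0
  above = count-none P (All.map (λ i<y (_ , y<i) → <-asym i<y y<i) (rows-above n i ss))

armLeg : CellSet → Cell → ℕ × ℕ
armLeg G x = arm G x , leg G x

armLegsByArm : ℕ → List ℕ → List ℕ → List (ℕ × ℕ)
armLegsByArm n pre ss = concatMap (λ t → map (n ∸ suc t ,_) (earlierCountsFrom (n ∸ suc t) pre ss)) (upTo n)

armLegs-rows : ∀ n pre ss → All (λ p → All (p ≤_) ss) pre → AllPairs _≤_ ss →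
  map (armLeg (rows n 0 (pre ++ ss))) (rows n (length pre) ss) ↭ armLegsByArm n pre ss
armLegs-rows n pre []       _   _                = ↭-reflexive (sym (concatMap-[] (upTo n)))
armLegs-rows n pre (s ∷ ss) pre≤ (s≤ss ∷ sorted) = begin
  map h (rowCells n i s ++ rows n i ss)            ≡⟨ map-++ h (rowCells n i s) _ ⟩
  map h (rowCells n i s) ++ map h (rows n i ss)    ≡⟨ cong (_++ map h (rows n i ss)) row ⟩
  map u (upTo n) ++ map h (rows n i ss)            ↭⟨ ++⁺ˡ (map u (upTo n)) rest ⟩
  map u (upTo n) ++ armLegsByArm n (pre ∷ʳ s) ss   ↭⟨ concatMap-∷ u _ (upTo n) ⟨
  armLegsByArm n pre (s ∷ ss)                      ∎
  where
  open PermutationReasoning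
  h = armLeg (rows n 0 (pre ++ s ∷ ss))
  i = suc (length pre)
  u : ℕ → ℕ × ℕ
  u t = n ∸ suc t , closeCount (n ∸ suc t) s pre
  row : map h (rowCells n i s) ≡ map u (upTo n)
  row = trans (sym (map-∘ (upTo n)))
              (map-cong-local (All.map (λ t<n → cong₂ _,_ (arm-rows n pre s ss _) (leg-rows n pre s ss _ t<n (All.map All.head pre≤)))
                                       (all-upTo n)))
  rest : map h (rows n i ss) ↭ armLegsByArm n (pre ∷ʳ s) ss
  rest = subst₂ (λ xs r → map (armLeg (rows n 0 xs)) (rows n r ss) ↭ armLegsByArm n (pre ∷ʳ s) ss)
                (++-assoc pre [ s ] ss) (length-∷ʳ pre s)
                (armLegs-rows n (pre ∷ʳ s) ss (∷ʳ⁺ (All.map All.tail pre≤) s≤ss) sorted)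

AL-rows : ∀ n {ss} → AllPairs _≤_ ss → AL (rows n 0 ss) ↭ armLegsByArm n [] ss
AL-rows n {ss} = armLegs-rows n [] ss []

AL-rows-reflect : ∀ n {lo hi vs} → AllPairs _≥_ vs → All (_≤ hi) vs → All (lo ≤_) vs →
  AL (rows n 0 (map (hi ∸_) vs)) ↭ AL (rows n 0 (map (_∸ lo) (reverse vs)))
AL-rows-reflect n {lo} {hi} {vs} antitone ≤hi lo≤ = begin
  AL (rows n 0 (map (hi ∸_) vs))
    ↭⟨ AL-rows n (AllPairsₚ.map⁺ (AllPairs.map (∸-monoʳ-≤ hi) antitone)) ⟩
  armLegsByArm n [] (map (hi ∸_) vs)
    ↭⟨ concatMap-cong-↭ (λ t → map⁺ _ (earlierCounts-reflect (n ∸ suc t) antitone ≤hi lo≤)) (upTo n) ⟩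
  armLegsByArm n [] (map (_∸ lo) (reverse vs))
    ↭⟨ AL-rows n (AllPairsₚ.map⁺ (AllPairs.map (∸-monoˡ-≤ lo) (AllPairs-reverse antitone))) ⟨
  AL (rows n 0 (map (_∸ lo) (reverse vs)))
    ∎
  where open PermutationReasoning

tabulate-inject₁ : ∀ {a} {A : Set a} {k} (f : Fin (suc k) → A) → tabulate f ≡ tabulate (f ∘ inject₁) ∷ʳ f (fromℕ k)
tabulate-inject₁ {k = zero}  f = refl
tabulate-inject₁ {k = suc k} f = cong (f fzero ∷_) (tabulate-inject₁ (f ∘ fsuc))

tabulate-opposite : ∀ {a} {A : Set a} {k} (f : Fin k → A) → tabulate (f ∘ opposite) ≡ reverse (tabulate f)
tabulate-opposite {k = zero}  f = refl
tabulate-opposite {k = suc k} f = begin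
  f (fromℕ k) ∷ tabulate (f ∘ inject₁ ∘ opposite)       ≡⟨ cong (f (fromℕ k) ∷_) (tabulate-opposite (f ∘ inject₁)) ⟩
  f (fromℕ k) ∷ reverse (tabulate (f ∘ inject₁))        ≡⟨ reverse-++ (tabulate (f ∘ inject₁)) [ f (fromℕ k) ] ⟨
  reverse (tabulate (f ∘ inject₁) ∷ʳ f (fromℕ k))       ≡⟨ cong reverse (tabulate-inject₁ f) ⟨
  reverse (tabulate f)                                  ∎
  where open ≡-Reasoning

rows-tabulate : ∀ n r {k} (sh : Fin k → ℕ) → concat (tabulate (λ f → rowCells n (r + suc (toℕ f)) (sh f))) ≡ rows n r (tabulate sh)
rows-tabulate n r {zero}  sh = refl
rows-tabulate n r {suc k} sh = cong₂ _++_
  (cong (λ i → rowCells n i (sh fzero)) (+-comm r 1))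
  (trans (cong concat (tabulate-cong (λ f → cong (λ i → rowCells n i (sh (fsuc f))) (+-suc r (suc (toℕ f))))))
         (rows-tabulate n (suc r) (sh ∘ fsuc)))

rows-allFin : ∀ n {k} (sh : Fin k → ℕ) → concatMap (λ f → rowCells n (suc (toℕ f)) (sh f)) (allFin k) ≡ rows n 0 (tabulate sh)
rows-allFin n sh = trans (cong concat (map-tabulate (λ f → f) (λ f → rowCells n (suc (toℕ f)) (sh f)))) (rows-tabulate n 0 sh)

theorem1p3 : (n m : ℕ) → 1 ≤ n → (α : Fin (suc m) → ℕ) → α fzero ≤ n →
    (∀ (i j : Fin (suc m)) → i ≤ᶠ j → α j ≤ α i) →
    AL (T n m α) ↭ AL (T* n m α)
theorem1p3 n m _ α _ antitone = begin
  AL (T n m α)                                     ≡⟨ cong AL T-rows ⟩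
  AL (rows n 0 (map (α fzero ∸_) αs))              ↭⟨ AL-rows-reflect n αs-antitone (tabulate⁺ (λ i → antitone fzero i z≤n))
                                                                                  (tabulate⁺ (λ i → antitone i (fromℕ m) (≤fromℕ i))) ⟩
  AL (rows n 0 (map (_∸ α (fromℕ m)) (reverse αs))) ≡⟨ cong AL T*-rows ⟨
  AL (T* n m α)                                    ∎
  where
  open PermutationReasoning
  αs = tabulate α
  αs-antitone : AllPairs _≥_ αs
  αs-antitone = AllPairsₚ.tabulate⁺-< (λ i<j → antitone _ _ (<⇒≤ i<j))
  T-rows : T n m α ≡ rows n 0 (map (α fzero ∸_) αs)
  T-rows = trans (rows-allFin n (λ f → α fzero ∸ α f)) (cong (rows n 0) (sym (map-tabulate α (α fzero ∸_))))
  T*-rows : T* n m α ≡ rows n 0 (map (_∸ α (fromℕ m)) (reverse αs))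
  T*-rows = trans (rows-allFin n (λ f → α (opposite f) ∸ α (fromℕ m)))
                  (cong (rows n 0) (trans (sym (map-tabulate (α ∘ opposite) (_∸ α (fromℕ m))))
                                          (cong (map (_∸ α (fromℕ m))) (tabulate-opposite α))))
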